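{- Let $T$ be a finite tree. There exists a maximum matching $M$ of $T$ such that $M\cap\operatorname{ConnE}(T)=\emptyset$.
   Context: $\mathcal{N}(T)$ is the null space of the adjacency matrix of $T$; $\operatorname{Supp}(T)=\{v: x_v\neq0\text{ for some }x\in\mathcal{N}(T)\}$; $N[X]=\bigcup_{u\in X}(N(u)\cup\{u\})$. $\mathcal{F}_{S}(T)$ is the set of connected components of $T\langle N[\operatorname{Supp}(T)]\rangle$; $\mathcal{F}_{N}(T)$ is the set of connected components of the forest obtained from $T$ by deleting the vertices of $N[\operatorname{Supp}(T)]$. $\operatorname{ConnE}(T)$ is the set of edges of $T$ belonging to no tree of $\mathcal{F}_{S}(T)$ and to no tree of $\mathcal{F}_{N}(T)$. -}

module Defs where

open import Data.Nat using (ℕ; zero; suc; _≤_)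
open import Data.Fin using (Fin; zero; suc)
open import Data.Bool using (Bool; true; false; if_then_else_)
open import Data.Product using (Σ; _×_; _,_; ∃; ∃-syntax)
open import Data.Sum using (_⊎_)
open import Data.Unit using (⊤)
open import Data.List using (List; []; _∷_; length)
open import Data.List.Membership.Propositional using (_∈_)
open import Data.List.Relation.Unary.Unique.Propositional using (Unique)
open import Relation.Binary.PropositionalEquality using (_≡_; _≢_)
open import Relation.Nullary using (¬_)
open import Data.Rational using (ℚ; 0ℚ; 1ℚ; _+_; _*_)

record Graph (n : ℕ) : Set where
  field
    adj   : Fin n → Fin n → Bool
    sym   : ∀ u v → adj u v ≡ adj v u
    irref : ∀ u → adj u u ≡ false

open Graph public

module _ {n : ℕ} (G : Graph n) where

  Edge : Fin n → Fin n → Set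
  Edge u v = adj G u v ≡ true

  data Reach (P : Fin n → Set) : Fin n → Fin n → Set where
    here  : ∀ {u} → P u → Reach P u u
    there : ∀ {u w v} → P u → Edge u w → Reach P w v → Reach P u v

  Connected : Set
  Connected = ∀ u v → Reach (λ _ → ⊤) u v

  data Chain : List (Fin n) → Set where
    nil  : Chain []
    one  : ∀ {u} → Chain (u ∷ [])
    cons : ∀ {u w vs} → Edge u w → Chain (w ∷ vs) → Chain (u ∷ w ∷ vs)

  last : Fin n → List (Fin n) → Fin n
  last u []       = u
  last _ (w ∷ ws) = last w ws

  -- a cycle: distinct vertices v₀ … v_k (k ≥ 2), consecutive ones adjacent
  -- and v_k adjacent to v₀
  Cycle : Set
  Cycle = Σ (Fin n) λ a → Σ (Fin n) λ b → Σ (Fin n) λ c → Σ (List (Fin n)) λ rest →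
          Unique (a ∷ b ∷ c ∷ rest) × Chain (a ∷ b ∷ c ∷ rest) × Edge (last c rest) a

  IsTree : Set
  IsTree = Connected × ¬ Cycle

  Covers : List (Fin n × Fin n) → Fin n → Set
  Covers M x = Σ (Fin n × Fin n) λ e → e ∈ M × (Data.Product.proj₁ e ≡ x ⊎ Data.Product.proj₂ e ≡ x)

  data IsMatching : List (Fin n × Fin n) → Set where
    []  : IsMatching []
    _∷_ : ∀ {u v M} → Edge u v × ¬ Covers M u × ¬ Covers M v →
          IsMatching M → IsMatching ((u , v) ∷ M)

  IsMaximumMatching : List (Fin n × Fin n) → Set
  IsMaximumMatching M = IsMatching M × (∀ M' → IsMatching M' → length M' ≤ length M)

  A : Fin n → Fin n → ℚ
  A u v = if adj G u v then 1ℚ else 0ℚ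

  sumFin : ∀ {m} → (Fin m → ℚ) → ℚ
  sumFin {zero}  f = 0ℚ
  sumFin {suc m} f = f zero + sumFin (λ i → f (suc i))

  InNullSpace : (Fin n → ℚ) → Set
  InNullSpace x = ∀ i → sumFin (λ j → A i j * x j) ≡ 0ℚ

  Supp : Fin n → Set
  Supp v = Σ (Fin n → ℚ) λ x → InNullSpace x × x v ≢ 0ℚ

  NSupp : Fin n → Set
  NSupp v = Σ (Fin n) λ u → Supp u × (u ≡ v ⊎ Edge u v)

  -- Connected components of the induced subgraph G⟨S⟩.
  -- The component containing r ∈ S has vertex set {w | Reach S r w} and
  -- edge set the edges of G⟨S⟩ between its vertices.

  EdgeOfComponent : (S : Fin n → Set) → Fin n → Fin n → Fin n → Set
  EdgeOfComponent S r u v = Reach S r u × Reach S r v × S u × S v × Edge u v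

  EdgeInSomeComponent : (S : Fin n → Set) → Fin n → Fin n → Set
  EdgeInSomeComponent S u v = Σ (Fin n) λ r → S r × EdgeOfComponent S r u v

  -- F_S(T): components of T⟨N[Supp T]⟩;  F_N(T): components of T − N[Supp T]
  InFS : Fin n → Fin n → Set
  InFS = EdgeInSomeComponent NSupp

  InFN : Fin n → Fin n → Set
  InFN = EdgeInSomeComponent (λ v → ¬ NSupp v)

  ConnE : Fin n → Fin n → Set
  ConnE u v = Edge u v × ¬ InFS u v × ¬ InFN u v

-- M is built by the greedy leaf algorithm: keep a set W of live vertices
-- (initially all); while the forest T⟨W⟩ has an edge it has a leaf ℓ with
-- neighbour p, so match ℓp and kill ℓ and p.  An exchange argument shows that
-- this matching is maximum.  To see that no matched edge is in ConnE, we keep two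
-- invariants of W relating the null space of T to that of T⟨W⟩:
--   (F) every null vector of T vanishes on the dead neighbours of W;
--   (B) every null vector of T⟨W⟩ extends to a null vector of T.
-- Both survive the removal of a leaf and its neighbour.  When ℓp is matched,
-- the leaf equation and (F) give x_p = 0 for every null vector x, and all
-- other neighbours of ℓ are dead.  If a live neighbour w ≠ ℓ of p had x_w ≠ 0,
-- cutting x down to the component of w in T⟨W ∖ {ℓ,p}⟩ and correcting it at ℓ
-- gives, by (B), a null vector nonzero at ℓ.  So either ℓ ∈ Supp and ℓp lies in
-- F_S, or ℓ, p ∉ N[Supp] and ℓp lies in F_N.

module Submission where

open import Defs hiding (sym)
open import Data.Nat as ℕ using (ℕ; zero; suc; _≤_; _<_; z≤n; s≤s)
import Data.Nat.Properties as ℕP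
open import Data.Fin using (Fin; zero; suc) renaming (_<_ to _<ᶠ_)
open import Data.Fin.Properties using (_≟_; any?; all?; pigeonhole; suc-injective)
open import Data.Bool as Bool using (Bool; true; false; if_then_else_)
open import Data.Product using (Σ; _×_; _,_; proj₁; proj₂)
open import Data.Sum using (_⊎_; inj₁; inj₂)
open import Data.Empty using (⊥-elim)
open import Data.List using (List; []; _∷_; length; lookup; filter)
open import Data.List.Properties using (filter-all; filter-accept; filter-reject)
open import Data.List.Membership.Propositional using (_∈_)
open import Data.List.Relation.Unary.Any using (here; there)
open import Data.List.Relation.Unary.All using (All; []; _∷_)
import Data.List.Relation.Unary.All as All
open import Data.List.Relation.Unary.All.Properties using (¬Any⇒All¬)
open import Data.List.Membership.Propositional.Properties using (∈-lookup; ∈-filter⁻)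
open import Data.List.Relation.Unary.AllPairs using ([]; _∷_)
open import Data.List.Relation.Unary.Unique.Propositional using (Unique)
open import Function using (_∘_)
open import Relation.Binary.PropositionalEquality
open import Relation.Nullary using (¬_; Dec; yes; no; does)
open import Relation.Nullary.Decidable using (_×-dec_; _→-dec_; _⊎-dec_; ¬?; map′; dec-true)
open import Relation.Nullary.Decidable.Core using (¬¬-excluded-middle)
open import Data.Rational using (ℚ; 0ℚ; 1ℚ; _+_; _*_; -_)
import Data.Rational.Properties as ℚP
open import Algebra.Bundles using (Ring)
import Algebra.Properties.Semiring.Sum (Ring.semiring ℚP.+-*-ring) as ∑

module _ {n : ℕ} (G : Graph n) where

  open import Data.List.Membership.DecPropositional (_≟_ {n}) using (_∈?_)

  sumFin≡∑ : ∀ {m} (f : Fin m → ℚ) → sumFin G f ≡ ∑.sum f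
  sumFin≡∑ {zero}  f = refl
  sumFin≡∑ {suc m} f = cong (f zero +_) (sumFin≡∑ (f ∘ suc))

  sumFin-cong : ∀ {m} {f g : Fin m → ℚ} → (∀ j → f j ≡ g j) → sumFin G f ≡ sumFin G g
  sumFin-cong {f = f} {g} f≗g = trans (sumFin≡∑ f) (trans (∑.sum-cong-≗ f≗g) (sym (sumFin≡∑ g)))

  sumFin-zero : ∀ {m} {f : Fin m → ℚ} → (∀ j → f j ≡ 0ℚ) → sumFin G f ≡ 0ℚ
  sumFin-zero {m} f≗0 = trans (sumFin-cong f≗0) (trans (sumFin≡∑ {m} (λ _ → 0ℚ)) (∑.sum-replicate-zero m))

  sumFin-+ : ∀ {m} (f g : Fin m → ℚ) → sumFin G (λ j → f j + g j) ≡ sumFin G f + sumFin G g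
  sumFin-+ f g = trans (sumFin≡∑ (λ j → f j + g j))
    (trans (∑.∑-distrib-+ f g) (sym (cong₂ _+_ (sumFin≡∑ f) (sumFin≡∑ g))))

  sumFin-single : ∀ {m} {f : Fin m → ℚ} (k : Fin m) → (∀ j → j ≢ k → f j ≡ 0ℚ) → sumFin G f ≡ f k
  sumFin-single {f = f} zero others =
    trans (cong (f zero +_) (sumFin-zero (λ j → others (suc j) λ ()))) (ℚP.+-identityʳ (f zero))
  sumFin-single {f = f} (suc k) others =
    trans (cong₂ _+_ (others zero λ ()) (sumFin-single k (λ j j≢k → others (suc j) (j≢k ∘ suc-injective))))
          (ℚP.+-identityˡ _)

  E : Fin n → Fin n → Set
  E = Edge G

  edge-sym : ∀ {u v} → E u v → E v u
  edge-sym {u} {v} e = trans (Graph.sym G v u) e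

  edge-irrefl : ∀ {u v} → E u v → u ≢ v
  edge-irrefl {u} e refl with trans (sym e) (irref G u)
  ... | ()

  edge? : ∀ u v → Dec (E u v)
  edge? u v = adj G u v Bool.≟ true

  row : (Fin n → ℚ) → Fin n → ℚ
  row y i = sumFin G (λ j → A G i j * y j)

  term-edge : ∀ {i j} (q : ℚ) → E i j → A G i j * q ≡ q
  term-edge q e rewrite e = ℚP.*-identityˡ q

  term-vanishes : ∀ {i j} {q : ℚ} → (E i j → q ≡ 0ℚ) → A G i j * q ≡ 0ℚ
  term-vanishes {i} {j} {q} h with adj G i j
  ... | true  = cong (1ℚ *_) (h refl)
  ... | false = ℚP.*-zeroˡ q

  row-cong : ∀ {y z : Fin n → ℚ} i → (∀ j → E i j → y j ≡ z j) → row y i ≡ row z i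
  row-cong {y} {z} i agree = sumFin-cong term
    where
    term : ∀ j → A G i j * y j ≡ A G i j * z j
    term j with edge? i j
    ... | yes e = cong (A G i j *_) (agree j e)
    ... | no ¬e = trans (term-vanishes (⊥-elim ∘ ¬e)) (sym (term-vanishes (⊥-elim ∘ ¬e)))

  row-zero : ∀ {y : Fin n → ℚ} i → (∀ j → E i j → y j ≡ 0ℚ) → row y i ≡ 0ℚ
  row-zero i vanish = sumFin-zero (λ j → term-vanishes (vanish j))

  row-single : ∀ {y : Fin n → ℚ} i k → E i k → (∀ j → j ≢ k → E i j → y j ≡ 0ℚ) → row y i ≡ y k
  row-single {y} i k e vanish =
    trans (sumFin-single k (λ j j≢k → term-vanishes (vanish j j≢k))) (term-edge (y k) e)

  row-+ : ∀ (y z : Fin n → ℚ) i → row (λ v → y v + z v) i ≡ row y i + row z i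
  row-+ y z i = trans (sumFin-cong (λ j → ℚP.*-distribˡ-+ (A G i j) (y j) (z j)))
                      (sumFin-+ (λ j → A G i j * y j) (λ j → A G i j * z j))

  VSet : Set
  VSet = Fin n → Bool

  live≢dead : ∀ {b : Bool} → b ≡ true → b ≢ false
  live≢dead refl ()

  mask : VSet → (Fin n → ℚ) → Fin n → ℚ
  mask S y v = if S v then y v else 0ℚ

  mask-in : ∀ {S y v} → S v ≡ true → mask S y v ≡ y v
  mask-in h rewrite h = refl

  mask-out : ∀ {S y v} → S v ≡ false → mask S y v ≡ 0ℚ
  mask-out h rewrite h = refl

  -- y is a null vector of the induced subgraph G⟨W⟩, extended by zero
  record LocalNull (W : VSet) (y : Fin n → ℚ) : Set where
    field
      outside : ∀ v → W v ≡ false → y v ≡ 0ℚ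
      rows    : ∀ i → W i ≡ true → row y i ≡ 0ℚ
  open LocalNull

  record LeafOf (W : VSet) (ℓ p : Fin n) : Set where
    field
      ℓ-live : W ℓ ≡ true
      p-live : W p ≡ true
      edge   : E ℓ p
      only-p : ∀ u → W u ≡ true → E ℓ u → u ≡ p
  open LeafOf

  leaf-forces-zero : ∀ {W ℓ p y} → LeafOf W ℓ p → LocalNull W y → y p ≡ 0ℚ
  leaf-forces-zero {W} {ℓ} {p} {y} lf null =
    trans (sym (row-single ℓ p (edge lf) others)) (rows null ℓ (ℓ-live lf))
    where
    others : ∀ j → j ≢ p → E ℓ j → y j ≡ 0ℚ
    others j j≢p e with W j in live
    ... | true  = ⊥-elim (j≢p (only-p lf j live e))
    ... | false = outside null j live

  remove : VSet → Fin n → Fin n → VSet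
  remove W ℓ p v with v ≟ ℓ | v ≟ p
  ... | yes _ | _     = false
  ... | no _  | yes _ = false
  ... | no _  | no _  = W v

  remove-ℓ : ∀ W ℓ p → remove W ℓ p ℓ ≡ false
  remove-ℓ W ℓ p with ℓ ≟ ℓ
  ... | yes _ = refl
  ... | no ℓ≢ℓ = ⊥-elim (ℓ≢ℓ refl)

  remove-p : ∀ W ℓ p → remove W ℓ p p ≡ false
  remove-p W ℓ p with p ≟ ℓ | p ≟ p
  ... | yes _ | _      = refl
  ... | no _  | yes _  = refl
  ... | no _  | no p≢p = ⊥-elim (p≢p refl)

  remove-other : ∀ W ℓ p v → v ≢ ℓ → v ≢ p → remove W ℓ p v ≡ W v
  remove-other W ℓ p v v≢ℓ v≢p with v ≟ ℓ | v ≟ p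
  ... | yes v≡ℓ | _       = ⊥-elim (v≢ℓ v≡ℓ)
  ... | no _    | yes v≡p = ⊥-elim (v≢p v≡p)
  ... | no _    | no _    = refl

  remove-live : ∀ W ℓ p v → remove W ℓ p v ≡ true → W v ≡ true × v ≢ ℓ × v ≢ p
  remove-live W ℓ p v live with v ≟ ℓ | v ≟ p
  remove-live W ℓ p v () | yes _ | _
  remove-live W ℓ p v () | no _  | yes _
  ... | no v≢ℓ | no v≢p = live , v≢ℓ , v≢p

  remove-dead : ∀ W ℓ p v → remove W ℓ p v ≡ false → W v ≡ false ⊎ v ≡ ℓ ⊎ v ≡ p
  remove-dead W ℓ p v dead with v ≟ ℓ | v ≟ p
  ... | yes v≡ℓ | _       = inj₂ (inj₁ v≡ℓ)
  ... | no _    | yes v≡p = inj₂ (inj₂ v≡p)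
  ... | no _    | no _    = inj₁ dead

  remove-keeps-dead : ∀ W ℓ p v → W v ≡ false → remove W ℓ p v ≡ false
  remove-keeps-dead W ℓ p v dead with v ≟ ℓ | v ≟ p
  ... | yes _ | _     = refl
  ... | no _  | yes _ = refl
  ... | no _  | no _  = dead

  Frontier : VSet → Set
  Frontier W = ∀ x → InNullSpace G x → ∀ v s → W v ≡ true → E v s → W s ≡ false → x s ≡ 0ℚ

  restrict-null : ∀ {W} → Frontier W → ∀ x → InNullSpace G x → LocalNull W (mask W x)
  restrict-null {W} frontier x null-x = record { outside = λ v → mask-out {W} {x} ; rows = rows′ }
    where
    rows′ : ∀ i → W i ≡ true → row (mask W x) i ≡ 0ℚ
    rows′ i live = trans (row-cong i agree) (null-x i)
      where
      agree : ∀ j → E i j → mask W x j ≡ x j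
      agree j e with W j in wj
      ... | true  = refl
      ... | false = sym (frontier x null-x i j live e wj)

  leaf-neighbour-vanishes : ∀ {W ℓ p} → LeafOf W ℓ p → Frontier W → ∀ x → InNullSpace G x → x p ≡ 0ℚ
  leaf-neighbour-vanishes {W} lf frontier x null-x =
    trans (sym (mask-in {W} {x} (p-live lf))) (leaf-forces-zero lf (restrict-null frontier x null-x))

  frontier-step : ∀ {W ℓ p} → LeafOf W ℓ p → Frontier W → Frontier (remove W ℓ p)
  frontier-step {W} {ℓ} {p} lf frontier x null-x v s live e dead with remove-live W ℓ p v live
  ... | v-live , _ , v≢p with remove-dead W ℓ p s dead
  ...   | inj₁ s-dead        = frontier x null-x v s v-live e s-dead
  ...   | inj₂ (inj₁ refl)   = ⊥-elim (v≢p (only-p lf v v-live (edge-sym e)))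
  ...   | inj₂ (inj₂ refl)   = leaf-neighbour-vanishes lf frontier x null-x

  Extendable : VSet → Set
  Extendable W = ∀ y → LocalNull W y →
                 Σ (Fin n → ℚ) λ x → InNullSpace G x × (∀ v → W v ≡ true → x v ≡ y v)

  point : Fin n → ℚ → Fin n → ℚ
  point k c v with v ≟ k
  ... | yes _ = c
  ... | no _  = 0ℚ

  point-at : ∀ k c → point k c k ≡ c
  point-at k c with k ≟ k
  ... | yes _  = refl
  ... | no k≢k = ⊥-elim (k≢k refl)

  point-off : ∀ k c v → v ≢ k → point k c v ≡ 0ℚ
  point-off k c v v≢k with v ≟ k
  ... | yes v≡k = ⊥-elim (v≢k v≡k)
  ... | no _    = refl

  row-point-edge : ∀ {i k} c → E i k → row (point k c) i ≡ c
  row-point-edge {i} {k} c e = trans (row-single i k e (λ j j≢k _ → point-off k c j j≢k)) (point-at k c)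

  row-point-nonedge : ∀ {i k} c → ¬ E i k → row (point k c) i ≡ 0ℚ
  row-point-nonedge {i} {k} c ¬e = row-zero i (λ j e → point-off k c j λ { refl → ¬e e })

  leaf-isolated : ∀ {W ℓ p} → LeafOf W ℓ p → ∀ j → E ℓ j → remove W ℓ p j ≡ false
  leaf-isolated {W} {ℓ} {p} lf j e with W j in wj
  ... | true  = subst (λ t → remove W ℓ p t ≡ false) (sym (only-p lf j wj e)) (remove-p W ℓ p)
  ... | false = remove-keeps-dead W ℓ p j wj

  -- A null vector z of G⟨W ∖ {ℓ,p}⟩ becomes one of G⟨W⟩ by placing −(A z)ₚ at
  -- the leaf ℓ: this balances the row of p, and no other live row sees ℓ.
  leafExtension : Fin n → Fin n → (Fin n → ℚ) → Fin n → ℚ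
  leafExtension ℓ p z v = z v + point ℓ (- row z p) v

  module _ {W ℓ p z} (lf : LeafOf W ℓ p) (null-z : LocalNull (remove W ℓ p) z) where

    leafExtension-at-ℓ : leafExtension ℓ p z ℓ ≡ - row z p
    leafExtension-at-ℓ =
      trans (cong₂ _+_ (outside null-z ℓ (remove-ℓ W ℓ p)) (point-at ℓ _)) (ℚP.+-identityˡ _)

    leafExtension-agrees : ∀ v → remove W ℓ p v ≡ true → leafExtension ℓ p z v ≡ z v
    leafExtension-agrees v live =
      trans (cong (z v +_) (point-off ℓ _ v (proj₁ (proj₂ (remove-live W ℓ p v live))))) (ℚP.+-identityʳ _)

    leafExtension-null : LocalNull W (leafExtension ℓ p z)
    leafExtension-null = record { outside = outside′ ; rows = λ i live → trans (row-+ z c i) (rows′ i live) }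
      where
      c : Fin n → ℚ
      c = point ℓ (- row z p)

      outside′ : ∀ v → W v ≡ false → leafExtension ℓ p z v ≡ 0ℚ
      outside′ v dead = cong₂ _+_ (outside null-z v (remove-keeps-dead W ℓ p v dead)) (point-off ℓ _ v v≢ℓ)
        where
        v≢ℓ : v ≢ ℓ
        v≢ℓ refl = live≢dead (ℓ-live lf) dead

      rows′ : ∀ i → W i ≡ true → row z i + row c i ≡ 0ℚ
      rows′ i live with i ≟ ℓ | i ≟ p
      ... | yes refl | _ =
        cong₂ _+_ (row-zero ℓ (λ j e → outside null-z j (leaf-isolated lf j e)))
                  (row-point-nonedge _ (λ e → edge-irrefl e refl))
      ... | no _ | yes refl =
        trans (cong (row z p +_) (row-point-edge _ (edge-sym (edge lf)))) (ℚP.+-inverseʳ (row z p))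
      ... | no i≢ℓ | no i≢p =
        cong₂ _+_ (rows null-z i (trans (remove-other W ℓ p i i≢ℓ i≢p) live))
                  (row-point-nonedge _ (λ e → i≢p (only-p lf i live (edge-sym e))))

  extendable-step : ∀ {W ℓ p} → LeafOf W ℓ p → Extendable W → Extendable (remove W ℓ p)
  extendable-step {W} {ℓ} {p} lf extendable y null-y
    with extendable (leafExtension ℓ p y) (leafExtension-null lf null-y)
  ... | x , null-x , agree =
    x , null-x ,
    λ v live → trans (agree v (proj₁ (remove-live W ℓ p v live))) (leafExtension-agrees lf null-y v live)

  reach-snoc : ∀ {P : Fin n → Set} {a b c} → Reach G P a b → E b c → P c → Reach G P a c
  reach-snoc (here pb)          e pc = there pb e (here pc)
  reach-snoc (there pa e′ walk) e pc = there pa e′ (reach-snoc walk e pc)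

  chain-reach : ∀ {P : Fin n → Set} {x xs w} →
                Chain G (x ∷ xs) → All P (x ∷ xs) → w ∈ (x ∷ xs) → Reach G P x w
  chain-reach _           (px ∷ _)   (here refl) = here px
  chain-reach (cons e ch) (px ∷ pxs) (there w∈)  = there px e (chain-reach ch pxs w∈)

  Path : (Fin n → Set) → Fin n → Fin n → Set
  Path P a b = Σ (List (Fin n)) λ ys →
               Chain G (a ∷ ys) × Unique (a ∷ ys) × All P (a ∷ ys) × last G a ys ≡ b

  path-suffix : ∀ {P : Fin n → Set} {a x xs} → a ∈ (x ∷ xs) → Chain G (x ∷ xs) → Unique (x ∷ xs) →
                All P (x ∷ xs) → Path P a (last G x xs)
  path-suffix {xs = xs}     (here refl) ch          u       pxs       = xs , ch , u , pxs , refl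
  path-suffix {xs = _ ∷ _} (there a∈)  (cons _ ch) (_ ∷ u) (_ ∷ pxs) = path-suffix a∈ ch u pxs

  -- a walk shortens to a path by cutting the loop at a repeated vertex
  walk→path : ∀ {P : Fin n → Set} {a b} → Reach G P a b → Path P a b
  walk→path (here pa) = [] , one , ([] ∷ []) , (pa ∷ []) , refl
  walk→path (there {u} {w} pu e walk) with walk→path walk
  ... | ys , ch , uniq , pys , end with u ∈? (w ∷ ys)
  ...   | no u∉  = w ∷ ys , cons e ch , (¬Any⇒All¬ _ u∉ ∷ uniq) , (pu ∷ pys) , end
  ...   | yes u∈ with path-suffix u∈ ch uniq pys
  ...     | zs , ch′ , uniq′ , pzs , end′ = zs , ch′ , uniq′ , pzs , trans end′ end

  -- The forest lemma: two distinct neighbours w, u of p are not joined by a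
  -- walk avoiding p, for it would close a cycle through p.
  no-detour : ¬ Cycle G → ∀ {P : Fin n → Set} {p w u} → ¬ P p → E w p → E u p → u ≢ w → ¬ Reach G P w u
  no-detour acyclic {P} {p} ¬Pp ewp eup u≢w walk with walk→path walk
  ... | []       , _  , _    , _   , end = u≢w (sym end)
  ... | c ∷ rest , ch , uniq , pys , end =
    acyclic (p , _ , c , rest , (All.map p≢ pys ∷ uniq) , cons (edge-sym ewp) ch , subst (λ t → E t p) (sym end) eup)
    where
    p≢ : ∀ {x} → P x → p ≢ x
    p≢ px refl = ¬Pp px

  Leaf : VSet → Set
  Leaf W = Σ (Fin n) λ ℓ → Σ (Fin n) λ p → LeafOf W ℓ p

  leaf? : ∀ W → Dec (Leaf W)
  leaf? W = map′ (λ (ℓ , p , a , b , c , d) → ℓ , p , record { ℓ-live = a ; p-live = b ; edge = c ; only-p = d })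
                 (λ (ℓ , p , lf) → ℓ , p , ℓ-live lf , p-live lf , edge lf , only-p lf)
                 (any? λ ℓ → any? λ p → (W ℓ Bool.≟ true) ×-dec (W p Bool.≟ true) ×-dec edge? ℓ p ×-dec
                    all? (λ u → (W u Bool.≟ true) →-dec edge? ℓ u →-dec u ≟ p))

  another-neighbour : ∀ {W h q} → ¬ Leaf W → W h ≡ true → W q ≡ true → E h q →
                      Σ (Fin n) λ w → W w ≡ true × E h w × w ≢ q
  another-neighbour {W} {h} {q} noLeaf h-live q-live e
    with any? (λ w → (W w Bool.≟ true) ×-dec edge? h w ×-dec ¬? (w ≟ q))
  ... | yes found = found
  ... | no none   = ⊥-elim (noLeaf (h , q , record { ℓ-live = h-live ; p-live = q-live ; edge = e ; only-p = only-q }))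
    where
    only-q : ∀ u → W u ≡ true → E h u → u ≡ q
    only-q u u-live eu with u ≟ q
    ... | yes u≡q = u≡q
    ... | no u≢q  = ⊥-elim (none (u , u-live , eu , u≢q))

  lookup-distinct : ∀ {xs : List (Fin n)} → Unique xs → ∀ {i j} → i <ᶠ j → lookup xs i ≢ lookup xs j
  lookup-distinct (x∉ ∷ _) {zero}  {suc j} _         = All.lookup x∉ (∈-lookup j)
  lookup-distinct (_ ∷ u)  {suc i} {suc j} (s≤s i<j) = lookup-distinct u i<j

  unique-length : ∀ {xs : List (Fin n)} → Unique xs → length xs ≤ n
  unique-length {xs} u with length xs ℕP.≤? n
  ... | yes ≤n = ≤n
  ... | no ≰n with pigeonhole (ℕP.≰⇒> ≰n) (lookup xs)
  ...   | i , j , i<j , same = ⊥-elim (lookup-distinct u i<j same)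

  LivePath : VSet → Fin n → Fin n → List (Fin n) → Set
  LivePath W h q rest =
    Unique (h ∷ q ∷ rest) × Chain G (h ∷ q ∷ rest) × All (λ v → W v ≡ true) (h ∷ q ∷ rest)

  -- a live path with at least k + 2 vertices
  LongPath : VSet → ℕ → Set
  LongPath W k =
    Σ (Fin n) λ h → Σ (Fin n) λ q → Σ (List (Fin n)) λ rest → LivePath W h q rest × k ≤ length rest

  extend-path : ∀ {W h q rest} → ¬ Cycle G → ¬ Leaf W → LivePath W h q rest →
                Σ (Fin n) λ w → LivePath W w h (q ∷ rest)
  extend-path {rest = rest} acyclic noLeaf (uniq@(h∉ ∷ _) , ch@(cons ehq ch′) , live@(h-live ∷ q-live ∷ _))
    with another-neighbour noLeaf h-live q-live ehq
  ... | w , w-live , ehw , w≢q with w ∈? (_ ∷ rest)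
  ...   | yes w∈ = ⊥-elim (no-detour acyclic (λ h≢h → h≢h refl) (edge-sym ehq) (edge-sym ehw) w≢q
                                      (chain-reach ch′ h∉ w∈))
  ...   | no w∉  =
    w , ((edge-irrefl (edge-sym ehw) ∷ ¬Any⇒All¬ _ w∉) ∷ uniq) , cons (edge-sym ehw) ch , w-live ∷ live

  long-path : ∀ {W u v} → ¬ Cycle G → ¬ Leaf W → LivePath W u v [] → ∀ k → LongPath W k
  long-path {u = u} {v} acyclic noLeaf base zero = u , v , [] , base , z≤n
  long-path acyclic noLeaf base (suc k) with long-path acyclic noLeaf base k
  ... | h , q , rest , path , k≤ with extend-path acyclic noLeaf path
  ...   | w , path′ = w , h , q ∷ rest , path′ , s≤s k≤

  leaf-or-edgeless : ¬ Cycle G → ∀ W → Leaf W ⊎ (∀ u v → W u ≡ true → W v ≡ true → ¬ E u v)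
  leaf-or-edgeless acyclic W with leaf? W
  ... | yes leaf  = inj₁ leaf
  ... | no noLeaf = inj₂ λ u v u-live v-live e → too-long (long-path acyclic noLeaf (base u-live v-live e) n)
    where
    base : ∀ {u v} → W u ≡ true → W v ≡ true → E u v → LivePath W u v []
    base u-live v-live e = ((edge-irrefl e ∷ []) ∷ [] ∷ []) , cons e one , u-live ∷ v-live ∷ []
    too-long : ¬ LongPath W n
    too-long (_ , _ , rest , (uniq , _) , n≤) =
      ℕP.<⇒≱ (ℕP.≤-trans (s≤s n≤) (ℕP.n≤1+n _)) (unique-length uniq)

  bit : Bool → ℕ
  bit true  = 1
  bit false = 0

  bit-mono : ∀ {a b} → (a ≡ true → b ≡ true) → bit a ≤ bit b
  bit-mono {false}        _   = z≤n
  bit-mono {true} {true}  _   = s≤s z≤n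
  bit-mono {true} {false} a⇒b with a⇒b refl
  ... | ()

  count : ∀ {m} → (Fin m → Bool) → ℕ
  count {zero}  S = 0
  count {suc m} S = bit (S zero) ℕ.+ count (S ∘ suc)

  count-mono : ∀ {m} {S T : Fin m → Bool} → (∀ v → T v ≡ true → S v ≡ true) → count T ≤ count S
  count-mono {zero}  T⊆S = z≤n
  count-mono {suc m} T⊆S = ℕP.+-mono-≤ (bit-mono (T⊆S zero)) (count-mono (T⊆S ∘ suc))

  count-< : ∀ {m} {S T : Fin m → Bool} → (∀ v → T v ≡ true → S v ≡ true) →
            ∀ k → T k ≡ false → S k ≡ true → count T < count S
  count-< {suc m} T⊆S zero    Tk Sk rewrite Tk | Sk = s≤s (count-mono (T⊆S ∘ suc))
  count-< {suc m} T⊆S (suc k) Tk Sk = ℕP.+-mono-≤-< (bit-mono (T⊆S zero)) (count-< (T⊆S ∘ suc) k Tk Sk)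

  count-remove : ∀ {W ℓ p} → LeafOf W ℓ p → count (remove W ℓ p) < count W
  count-remove {W} {ℓ} {p} lf =
    count-< (λ v live → proj₁ (remove-live W ℓ p v live)) ℓ (remove-ℓ W ℓ p) (ℓ-live lf)

  data Greedy (W : VSet) : List (Fin n × Fin n) → Set where
    done : (∀ u v → W u ≡ true → W v ≡ true → ¬ E u v) → Greedy W []
    step : ∀ {ℓ p M} → LeafOf W ℓ p → Greedy (remove W ℓ p) M → Greedy W ((ℓ , p) ∷ M)

  greedy : ¬ Cycle G → ∀ fuel W → count W < fuel → Σ (List (Fin n × Fin n)) (Greedy W)
  greedy acyclic (suc fuel) W bound with leaf-or-edgeless acyclic W
  ... | inj₂ edgeless    = [] , done edgeless
  ... | inj₁ (ℓ , p , lf)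
    with greedy acyclic fuel (remove W ℓ p) (ℕP.<-≤-trans (count-remove lf) (ℕP.≤-pred bound))
  ...   | M , run = (ℓ , p) ∷ M , step lf run

  Meets : Fin n × Fin n → Fin n → Set
  Meets e x = proj₁ e ≡ x ⊎ proj₂ e ≡ x

  LiveEdges : VSet → List (Fin n × Fin n) → Set
  LiveEdges W M = ∀ a b → (a , b) ∈ M → W a ≡ true × W b ≡ true

  greedy-matching : ∀ {W M} → Greedy W M → IsMatching G M × LiveEdges W M
  greedy-matching (done _) = [] , λ _ _ ()
  greedy-matching {W} (step {ℓ} {p} {M} lf run) with greedy-matching run
  ... | matching , live =
    (edge lf , uncovered (remove-ℓ W ℓ p) , uncovered (remove-p W ℓ p)) ∷ matching , live′
    where
    -- the rest of the run only covers vertices that stay live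
    uncovered : ∀ {x} → remove W ℓ p x ≡ false → ¬ Covers G M x
    uncovered dead ((a , b) , ab∈ , inj₁ refl) = live≢dead (proj₁ (live a b ab∈)) dead
    uncovered dead ((a , b) , ab∈ , inj₂ refl) = live≢dead (proj₂ (live a b ab∈)) dead

    live′ : LiveEdges W ((ℓ , p) ∷ M)
    live′ a b (here refl)  = ℓ-live lf , p-live lf
    live′ a b (there ab∈) =
      proj₁ (remove-live W ℓ p a (proj₁ (live a b ab∈))) ,
      proj₁ (remove-live W ℓ p b (proj₂ (live a b ab∈)))

  matching-edge : ∀ {M} → IsMatching G M → ∀ {a b} → (a , b) ∈ M → E a b
  matching-edge ((e , _) ∷ _)  (here refl)  = e
  matching-edge (_ ∷ matching) (there ab∈) = matching-edge matching ab∈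

  -- Exchange argument: deleting from any live matching M′ the edges touching
  -- ℓ or p loses at most one edge, since every live edge at ℓ also covers p.

  Touches : Fin n → Fin n → Fin n × Fin n → Set
  Touches ℓ p e = Meets e ℓ ⊎ Meets e p

  touches? : ∀ ℓ p e → Dec (Touches ℓ p e)
  touches? ℓ p e = ((proj₁ e ≟ ℓ) ⊎-dec (proj₂ e ≟ ℓ)) ⊎-dec ((proj₁ e ≟ p) ⊎-dec (proj₂ e ≟ p))

  strip : Fin n → Fin n → List (Fin n × Fin n) → List (Fin n × Fin n)
  strip ℓ p = filter (¬? ∘ touches? ℓ p)

  strip-matching : ∀ {ℓ p M} → IsMatching G M → IsMatching G (strip ℓ p M)
  strip-matching [] = []
  strip-matching {ℓ} {p} (_∷_ {u} {v} (e , u-free , v-free) matching) with touches? ℓ p (u , v)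
  ... | yes t  = subst (IsMatching G) (sym (filter-reject (¬? ∘ touches? ℓ p) (λ ¬t → ¬t t)))
                       (strip-matching matching)
  ... | no ¬t = subst (IsMatching G) (sym (filter-accept (¬? ∘ touches? ℓ p) ¬t))
                       ((e , u-free ∘ covers-strip , v-free ∘ covers-strip) ∷ strip-matching matching)
    where
    covers-strip : ∀ {x M} → Covers G (strip ℓ p M) x → Covers G M x
    covers-strip (e , e∈ , meets) = e , proj₁ (∈-filter⁻ (¬? ∘ touches? ℓ p) e∈) , meets

  module _ {W ℓ p} (lf : LeafOf W ℓ p) where

    touches-covers-p : ∀ {a b} → W a ≡ true → W b ≡ true → E a b → Touches ℓ p (a , b) → Meets (a , b) p
    touches-covers-p _      b-live e (inj₁ (inj₁ refl)) = inj₂ (only-p lf _ b-live e)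
    touches-covers-p a-live _      e (inj₁ (inj₂ refl)) = inj₁ (only-p lf _ a-live (edge-sym e))
    touches-covers-p _      _      _ (inj₂ meets-p)     = meets-p

    strip-live : ∀ {M} → LiveEdges W M → LiveEdges (remove W ℓ p) (strip ℓ p M)
    strip-live live a b ab∈ with ∈-filter⁻ (¬? ∘ touches? ℓ p) ab∈
    ... | ab∈M , ¬t =
      trans (remove-other W ℓ p a (¬t ∘ inj₁ ∘ inj₁) (¬t ∘ inj₂ ∘ inj₁)) (proj₁ (live a b ab∈M)) ,
      trans (remove-other W ℓ p b (¬t ∘ inj₁ ∘ inj₂) (¬t ∘ inj₂ ∘ inj₂)) (proj₂ (live a b ab∈M))

    strip-length : ∀ {M} → IsMatching G M → LiveEdges W M → length M ≤ suc (length (strip ℓ p M))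
    strip-length [] _ = z≤n
    strip-length (_∷_ {u} {v} {M} (e , u-free , v-free) matching) live with touches? ℓ p (u , v)
    ... | no ¬t = ℕP.≤-trans (s≤s (strip-length matching (λ a b ab∈ → live a b (there ab∈))))
                             (ℕP.≤-reflexive (cong (suc ∘ length) (sym (filter-accept (¬? ∘ touches? ℓ p) ¬t))))
    ... | yes t = ℕP.≤-reflexive (cong (suc ∘ length)
                    (sym (trans (filter-reject (¬? ∘ touches? ℓ p) (λ ¬t → ¬t t))
                                (filter-all (¬? ∘ touches? ℓ p) untouched))))
      where
      -- (u, v) covers p, so no later edge of the matching touches ℓ or p
      p-free : ¬ Covers G M p
      p-free with touches-covers-p (proj₁ (live u v (here refl))) (proj₂ (live u v (here refl))) e t
      ... | inj₁ refl = u-free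
      ... | inj₂ refl = v-free

      untouched : All (¬_ ∘ Touches ℓ p) M
      untouched = All.tabulate λ { {a , b} ab∈ t′ →
        p-free ((a , b) , ab∈ , touches-covers-p (proj₁ (live a b (there ab∈))) (proj₂ (live a b (there ab∈)))
                                                 (matching-edge matching ab∈) t′) }

  greedy-maximum : ∀ {W M} → Greedy W M →
                   ∀ M′ → IsMatching G M′ → LiveEdges W M′ → length M′ ≤ length M
  greedy-maximum (done _) [] _ _ = z≤n
  greedy-maximum (done edgeless) ((a , b) ∷ _) ((e , _) ∷ _) live =
    ⊥-elim (edgeless a b (proj₁ (live a b (here refl))) (proj₂ (live a b (here refl))) e)
  greedy-maximum (step {ℓ} {p} lf run) M′ matching live =
    ℕP.≤-trans (strip-length lf matching live)
               (s≤s (greedy-maximum run (strip ℓ p M′) (strip-matching matching) (strip-live lf live)))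

  -- a set S closed under live adjacency, i.e. a union of components of G⟨W⟩
  Closed : VSet → VSet → Set
  Closed W S = ∀ i j → S i ≡ true → W j ≡ true → E i j → S j ≡ true

  mask-closed-null : ∀ {W S y} → Closed W S → LocalNull W y → LocalNull W (mask S y)
  mask-closed-null {W} {S} {y} closed null = record { outside = outside′ ; rows = rows′ }
    where
    outside′ : ∀ v → W v ≡ false → mask S y v ≡ 0ℚ
    outside′ v dead with S v
    ... | true  = outside null v dead
    ... | false = refl

    rows′ : ∀ i → W i ≡ true → row (mask S y) i ≡ 0ℚ
    rows′ i live with S i in si
    ... | true  = trans (row-cong i inside) (rows null i live)
      where
      inside : ∀ j → E i j → mask S y j ≡ y j
      inside j e with S j in sj | W j in wj
      ... | true  | _     = refl
      ... | false | true  = ⊥-elim (live≢dead (closed i j si wj e) sj)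
      ... | false | false = sym (outside null j wj)
    ... | false = row-zero i outside-S
      where
      outside-S : ∀ j → E i j → mask S y j ≡ 0ℚ
      outside-S j e with S j in sj
      ... | true  = ⊥-elim (live≢dead (closed j i sj live (edge-sym e)) si)
      ... | false = refl

  ¬¬-decidable : ∀ {m} (Q : Fin m → Set) → ¬ ¬ (∀ v → Dec (Q v))
  ¬¬-decidable {zero}  Q k = k λ ()
  ¬¬-decidable {suc m} Q k =
    ¬¬-excluded-middle λ q₀? → ¬¬-decidable (Q ∘ suc) λ qs? → k λ { zero → q₀? ; (suc v) → qs? v }

  dec-witness : ∀ {Q : Set} (q? : Dec Q) → does q? ≡ true → Q
  dec-witness (yes q) _ = q
  dec-witness (no _)  ()

  -- Restricting y to the component of w in G⟨W⟩, which meets p only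
  -- in w, gives a null vector z of G⟨W⟩ with (A z)ₚ = y_w.  (The component is
  -- decidable only classically, hence the double negation.)
  component-vector : ¬ Cycle G → ∀ {W y w p} → LocalNull W y → W w ≡ true → W p ≡ false → E w p →
                     ¬ ¬ (Σ (Fin n → ℚ) λ z → LocalNull W z × row z p ≡ y w)
  component-vector acyclic {W} {y} {w} {p} null w-live p-dead ewp none =
    ¬¬-decidable C λ C? → none (mask (does ∘ C?) y , mask-closed-null (closed C?) null , at-p C?)
    where
    C : Fin n → Set
    C = Reach G (λ v → W v ≡ true) w

    closed : (C? : ∀ v → Dec (C v)) → Closed W (does ∘ C?)
    closed C? i j ci wj e = dec-true (C? j) (reach-snoc (dec-witness (C? i) ci) e wj)

    at-p : (C? : ∀ v → Dec (C v)) → row (mask (does ∘ C?) y) p ≡ y w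
    at-p C? = trans (row-single p w (edge-sym ewp) others) (mask-in {does ∘ C?} {y} (dec-true (C? w) (here w-live)))
      where
      others : ∀ j → j ≢ w → E p j → mask (does ∘ C?) y j ≡ 0ℚ
      others j j≢w epj with C? j
      ... | yes cj = ⊥-elim (no-detour acyclic (λ p-live → live≢dead p-live p-dead) ewp (edge-sym epj) j≢w cj)
      ... | no _   = refl

  -- If
  -- a live neighbour w ≠ ℓ of p is in Supp(G), so is ℓ: cut a null vector down to
  -- the component of w in G⟨W ∖ {ℓ,p}⟩, extend it at ℓ, and lift it by (B).
  leaf-in-support : ¬ Cycle G → ∀ {W ℓ p w} → LeafOf W ℓ p → Frontier W → Extendable W →
                    W w ≡ true → w ≢ ℓ → E w p → Supp G w → ¬ ¬ Supp G ℓ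
  leaf-in-support acyclic {W} {ℓ} {p} {w} lf frontier extendable w-live w≢ℓ ewp (x , null-x , xw≢0) ℓ∉Supp =
    component-vector acyclic (restrict-null (frontier-step lf frontier) x null-x) w-live′ (remove-p W ℓ p) ewp lift
    where
    w-live′ : remove W ℓ p w ≡ true
    w-live′ = trans (remove-other W ℓ p w w≢ℓ (edge-irrefl ewp)) w-live

    lift : ¬ (Σ (Fin n → ℚ) λ z → LocalNull (remove W ℓ p) z × row z p ≡ mask (remove W ℓ p) x w)
    lift (z , null-z , zp) with extendable (leafExtension ℓ p z) (leafExtension-null lf null-z)
    ... | x′ , null-x′ , agree = ℓ∉Supp (x′ , null-x′ , λ x′ℓ≡0 → xw≢0 (begin
      x w                       ≡⟨ sym (mask-in {remove W ℓ p} {x} w-live′) ⟩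
      mask (remove W ℓ p) x w   ≡⟨ sym zp ⟩
      row z p                   ≡⟨ ℚP.neg-injective (begin
        - row z p                 ≡⟨ sym (leafExtension-at-ℓ lf null-z) ⟩
        leafExtension ℓ p z ℓ     ≡⟨ sym (agree ℓ (ℓ-live lf)) ⟩
        x′ ℓ                      ≡⟨ x′ℓ≡0 ⟩
        0ℚ                        ∎) ⟩
      0ℚ                        ∎))
      where open ≡-Reasoning

  edge-in-component : ∀ (S : Fin n → Set) {u v} → S u → S v → E u v → EdgeInSomeComponent G S u v
  edge-in-component S su sv e = _ , su , here su , there su e (here sv) , su , sv , e

  -- An edge ℓp matched at a live set W satisfying (F) and (B) is not in ConnE:
  -- if ℓ ∈ Supp it lies in F_S, otherwise neither end is in N[Supp] and it lies in F_N.
  matched-not-ConnE : ¬ Cycle G → ∀ {W ℓ p} → LeafOf W ℓ p → Frontier W → Extendable W → ¬ ConnE G ℓ p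
  matched-not-ConnE acyclic {W} {ℓ} {p} lf frontier extendable (_ , ¬inFS , ¬inFN) =
    ¬inFN (edge-in-component _ ℓ∉N p∉N (edge lf))
    where
    ℓ∉Supp : ¬ Supp G ℓ
    ℓ∉Supp s = ¬inFS (edge-in-component (NSupp G) (ℓ , s , inj₁ refl) (ℓ , s , inj₂ (edge lf)) (edge lf))

    p∉Supp : ¬ Supp G p
    p∉Supp (x , null-x , xp≢0) = xp≢0 (leaf-neighbour-vanishes lf frontier x null-x)

    -- the neighbours of ℓ are p and dead vertices
    ℓ∉N : ¬ NSupp G ℓ
    ℓ∉N (_ , s , inj₁ refl) = ℓ∉Supp s
    ℓ∉N (u , s@(x , null-x , xu≢0) , inj₂ euℓ) with W u in wu
    ... | true  = p∉Supp (subst (Supp G) (only-p lf u wu (edge-sym euℓ)) s)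
    ... | false = xu≢0 (frontier x null-x ℓ u (ℓ-live lf) (edge-sym euℓ) wu)

    -- the neighbours of p are ℓ, dead vertices and live vertices covered by leaf-in-support
    p∉N : ¬ NSupp G p
    p∉N (_ , s , inj₁ refl) = p∉Supp s
    p∉N (u , s@(x , null-x , xu≢0) , inj₂ eup) with u ≟ ℓ | W u in wu
    ... | yes refl | _     = ℓ∉Supp s
    ... | no u≢ℓ   | true  = leaf-in-support acyclic lf frontier extendable wu u≢ℓ eup s ℓ∉Supp
    ... | no _     | false = xu≢0 (frontier x null-x p u (p-live lf) (edge-sym eup) wu)

  everyone : VSet
  everyone _ = true

  frontier-everyone : Frontier everyone
  frontier-everyone _ _ _ _ _ _ ()

  extendable-everyone : Extendable everyone
  extendable-everyone y null-y = y , (λ i → rows null-y i refl) , λ _ _ → refl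

  greedy-avoids-ConnE : ¬ Cycle G → ∀ {W M} → Greedy W M → Frontier W → Extendable W →
                        ∀ u v → (u , v) ∈ M → ¬ ConnE G u v
  greedy-avoids-ConnE acyclic (done _) _ _ _ _ ()
  greedy-avoids-ConnE acyclic (step lf run) frontier extendable _ _ (here refl) =
    matched-not-ConnE acyclic lf frontier extendable
  greedy-avoids-ConnE acyclic (step lf run) frontier extendable u v (there uv∈) =
    greedy-avoids-ConnE acyclic run (frontier-step lf frontier) (extendable-step lf extendable) u v uv∈

mainTheorem11 : (n : ℕ) (T : Graph n) → IsTree T →
    Σ (List (Fin n × Fin n)) λ M →
    IsMaximumMatching T M × (∀ u v → (u , v) ∈ M → ¬ ConnE T u v)
mainTheorem11 n T (_ , acyclic) with greedy T acyclic (suc (count T (everyone T))) (everyone T) (ℕP.n<1+n _)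
... | M , run =
  M ,
  (proj₁ (greedy-matching T run) , λ M′ matching → greedy-maximum T run M′ matching (λ _ _ _ → refl , refl)) ,
  greedy-avoids-ConnE T acyclic run (frontier-everyone T) (extendable-everyone T)
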